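{- For every integer $j\ge 3$ there exists a connected graph $G_j$ such that $meg(G_j)=j+2$ and $meg(G_j)<mag^-(G_j)$.
   Context: For an undirected graph $G$, two vertices $x,y$ monitor an edge $e$ if $e$ lies on every shortest path between $x$ and $y$; a monitoring edge-geodetic set (MEG-set) is a vertex set $M$ such that every edge is monitored by some pair of vertices of $M$, and $meg(G)$ is the minimum size of an MEG-set. For an oriented graph $\vec G$, two distinct vertices $x,y$ monitor an arc $a$ if $a$ lies on every shortest directed path from $x$ to $y$, or on every shortest directed path from $y$ to $x$; a monitoring arc-geodetic set (MAG-set) is a vertex set $M$ such that every arc is monitored by some pair of distinct vertices of $M$, and $mag(\vec G)$ is the minimum size of an MAG-set. $mag^-(G)$ is the minimum of $mag(\vec G)$ over all orientations $\vec G$ of $G$. -}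

module Defs where

open import Data.Nat using (ℕ; zero; suc; _≤_; _<_; _+_)
open import Data.Fin using (Fin)
open import Data.Fin.Subset using (Subset; _∈_; ∣_∣)
open import Data.Bool using (Bool; true; false)
open import Data.Product using (Σ; _×_; _,_; ∃; ∃-syntax)
open import Data.Sum using (_⊎_)
open import Relation.Binary.PropositionalEquality using (_≡_; _≢_)

record Graph (n : ℕ) : Set where
  field
    adj    : Fin n → Fin n → Bool
    sym    : ∀ u v → adj u v ≡ adj v u
    irrefl : ∀ u → adj u u ≡ false

open Graph public

data Walk {n : ℕ} (R : Fin n → Fin n → Bool) : Fin n → Fin n → Set where
  [] : ∀ {x} → Walk R x x
  step : ∀ {x z y} → R x z ≡ true → Walk R z y → Walk R x y

len : ∀ {n} {R : Fin n → Fin n → Bool} {x y} → Walk R x y → ℕ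
len [] = 0
len (step _ w) = suc (len w)

data Traverses {n : ℕ} {R : Fin n → Fin n → Bool} (u v : Fin n)
     : ∀ {x y} → Walk R x y → Set where
  here  : ∀ {y} (r : R u v ≡ true) (w : Walk R v y) → Traverses u v (step r w)
  there : ∀ {x z y} (r : R x z ≡ true) {w : Walk R z y} →
          Traverses u v w → Traverses u v (step r w)

Shortest : ∀ {n} {R : Fin n → Fin n → Bool} {x y} → Walk R x y → Set
Shortest {R = R} {x} {y} w = ∀ (w' : Walk R x y) → len w ≤ len w'

Connected : ∀ {n} → Graph n → Set
Connected G = ∀ x y → Walk (adj G) x y

EdgeOn : ∀ {n} {R : Fin n → Fin n → Bool} {x y} → Fin n → Fin n → Walk R x y → Set
EdgeOn u v w = Traverses u v w ⊎ Traverses v u w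

MonitorsEdge : ∀ {n} (G : Graph n) → Fin n → Fin n → Fin n → Fin n → Set
MonitorsEdge G x y u v =
  Walk (adj G) x y × (∀ (w : Walk (adj G) x y) → Shortest w → EdgeOn u v w)

IsMEGSet : ∀ {n} → Graph n → Subset n → Set
IsMEGSet G M = ∀ u v → adj G u v ≡ true →
  ∃[ x ] ∃[ y ] (x ∈ M × y ∈ M × MonitorsEdge G x y u v)

IsMeg : ∀ {n} → Graph n → ℕ → Set
IsMeg G k = (∃[ M ] (IsMEGSet G M × ∣ M ∣ ≡ k)) × (∀ M → IsMEGSet G M → k ≤ ∣ M ∣)

record Orientation {n : ℕ} (G : Graph n) : Set where
  field
    arc      : Fin n → Fin n → Bool
    arc-edge : ∀ u v → arc u v ≡ true → adj G u v ≡ true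
    edge-arc : ∀ u v → adj G u v ≡ true → (arc u v ≡ true) ⊎ (arc v u ≡ true)
    antisym  : ∀ u v → arc u v ≡ true → arc v u ≡ false

open Orientation public

MonitorsArcFrom : ∀ {n} {G : Graph n} (O : Orientation G) → Fin n → Fin n → Fin n → Fin n → Set
MonitorsArcFrom O x y u v =
  Walk (arc O) x y × (∀ (w : Walk (arc O) x y) → Shortest w → Traverses u v w)

MonitorsArc : ∀ {n} {G : Graph n} (O : Orientation G) → Fin n → Fin n → Fin n → Fin n → Set
MonitorsArc O x y u v = MonitorsArcFrom O x y u v ⊎ MonitorsArcFrom O y x u v

IsMAGSet : ∀ {n} {G : Graph n} → Orientation G → Subset n → Set
IsMAGSet O M = ∀ u v → arc O u v ≡ true →
  ∃[ x ] ∃[ y ] (x ∈ M × y ∈ M × x ≢ y × MonitorsArc O x y u v)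

IsMag : ∀ {n} {G : Graph n} → Orientation G → ℕ → Set
IsMag O k = (∃[ M ] (IsMAGSet O M × ∣ M ∣ ≡ k)) × (∀ M → IsMAGSet O M → k ≤ ∣ M ∣)

IsMagMinus : ∀ {n} → Graph n → ℕ → Set
IsMagMinus G k = (Σ (Orientation G) (λ O → IsMag O k)) × (∀ (O : Orientation G) k' → IsMag O k' → k ≤ k')

{-# OPTIONS --safe #-}

-- G_j is the net (the triangle t₀ t₁ t₂ with a pendant vertex sᵢ at each tᵢ) with j further
-- leaves attached to s₀; any j ≥ 1 works. A shortest path through the edge of a pendant vertex
-- ends there, so the j + 2 leaves lie in every MEG-set and every MAG-set, and they already
-- monitor all edges: meg(G_j) = j + 2.
-- In an orientation, a monitoring pair may trade a new leaf for its neighbour s₀, and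
-- contracting the new leaves onto s₀ preserves and reflects monitoring between vertices of the
-- net. A decision procedure for monitoring, run on all 2⁶ orientations of the net, finds in
-- each an arc that no two vertices off the triangle monitor. So every MAG-set also contains a
-- triangle vertex, and mag⁻(G_j) = j + 3, attained by orienting the triangle cyclically.

module Submission where

open import Defs hiding (sym)
open import Data.Bool using (Bool; true; false; _∧_; _∨_; not; if_then_else_; T)
import Data.Bool.Properties as Bool
open import Data.Empty using (⊥-elim)
open import Data.Fin using (Fin; zero; suc; toℕ; #_; _↑ˡ_; _↑ʳ_; splitAt)
open import Data.Fin.Properties
  using (_≟_; any?; all?; pigeonhole; ≤∧≢⇒<; ↑ˡ-injective;
         splitAt-↑ˡ; splitAt-↑ʳ; splitAt⁻¹-↑ˡ; splitAt⁻¹-↑ʳ)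
open import Data.Fin.Subset using (Subset; _∈_; _∉_; ∣_∣; ⊤; inside; outside)
open import Data.Fin.Subset.Properties
  using (anySubset?; _∈?_; ∈⊤; ∣⊤∣≡n; p⊆q⇒∣p∣≤∣q∣; p⊂q⇒∣p∣<∣q∣)
open import Data.Nat using (ℕ; zero; suc; pred; _+_; _≤_; _<_; _<ᵇ_; z≤n; s≤s)
import Data.Nat.Properties as ℕ
open import Data.Nat.Properties
  using (≤-refl; ≤-trans; ≤-pred; ≤-reflexive; ≮⇒≥; <⇒≤pred; <⇒≱; +-monoˡ-<; +-comm;
         1+n≰n; n≤1+n; m≤n⇒m≤1+n; module ≤-Reasoning)
open import Data.Product using (Σ; Σ-syntax; ∃; ∃₂; ∃-syntax; _×_; _,_; proj₁; proj₂; uncurry)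
open import Data.Product.Properties using (≡-dec)
open import Data.Sum using (_⊎_; inj₁; inj₂; fromInj₂; [_,_]′; map₁)
open import Data.Vec using (Vec; []; _∷_; _++_; lookup; tabulate; here; there)
open import Data.Vec.Properties using (lookup∘tabulate)
open import Function using (_∘_; flip; const; id; _⇔_; mk⇔; Equivalence)
open import Relation.Binary.PropositionalEquality
  using (_≡_; _≢_; refl; sym; trans; cong; cong₂; subst; subst₂)
open import Relation.Nullary using (Dec; yes; no; ¬_; does)
open import Relation.Nullary.Decidable
  using (map′; from-yes; dec-true; ¬?; _×-dec_; _⊎-dec_; _→-dec_; decidable-stable; toWitnessFalse)

BoolRel : ℕ → Set
BoolRel n = Fin n → Fin n → Bool

private variable
  n : ℕ
  R : BoolRel n
  x y z u v ℓ h : Fin n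

Monitors : BoolRel n → Fin n → Fin n → Fin n → Fin n → Set
Monitors R x y u v = Walk R x y × (∀ (w : Walk R x y) → Shortest w → Traverses u v w)

monitors-edge : {G : Graph n} → Monitors (adj G) x y u v → MonitorsEdge G x y u v
monitors-edge (w , all) = w , λ w′ sh → inj₁ (all w′ sh)

monitors-edge-reversed : {G : Graph n} → Monitors (adj G) x y v u → MonitorsEdge G x y u v
monitors-edge-reversed (w , all) = w , λ w′ sh → inj₂ (all w′ sh)

-- Walks

module _ {n : ℕ} {R : BoolRel n} where

  _++ʷ_ : ∀ {x y z} → Walk R x y → Walk R y z → Walk R x z
  [] ++ʷ w′ = w′
  step r w ++ʷ w′ = step r (w ++ʷ w′)

  len-++ʷ : ∀ {x y z} (w : Walk R x y) (w′ : Walk R y z) → len (w ++ʷ w′) ≡ len w + len w′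
  len-++ʷ [] w′ = refl
  len-++ʷ (step r w) w′ = cong suc (len-++ʷ w w′)

  cast : ∀ {x x′ y y′} → x ≡ x′ → y ≡ y′ → Walk R x y → Walk R x′ y′
  cast refl refl w = w

  len-cast : ∀ {x x′ y y′} (e : x ≡ x′) (e′ : y ≡ y′) (w : Walk R x y) →
             len (cast e e′ w) ≡ len w
  len-cast refl refl w = refl

  traverses-cast : ∀ {x x′ y y′ u v} (e : x ≡ x′) (e′ : y ≡ y′) {w : Walk R x y} →
                   Traverses u v (cast e e′ w) → Traverses u v w
  traverses-cast refl refl t = t

  traverses-step : ∀ {x z y u v} {r : R x z ≡ true} {w : Walk R z y} →
                   Traverses u v (step r w) → (x ≡ u × z ≡ v) ⊎ Traverses u v w
  traverses-step (here _ _) = inj₁ (refl , refl)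
  traverses-step (there _ t) = inj₂ t

  shortest-tail : ∀ {x z y} (r : R x z ≡ true) (w : Walk R z y) → Shortest (step r w) → Shortest w
  shortest-tail r w sh w′ = ≤-pred (sh (step r w′))

  vertexAt : ∀ {x y} (w : Walk R x y) → Fin (suc (len w)) → Fin n
  vertexAt {x} w zero = x
  vertexAt (step _ w) (suc i) = vertexAt w i

  prefix : ∀ {x y} (w : Walk R x y) (i : Fin (suc (len w))) →
           Σ[ w′ ∈ Walk R x (vertexAt w i) ] len w′ ≡ toℕ i
  prefix w zero = [] , refl
  prefix (step r w) (suc i) with prefix w i
  ... | w′ , e = step r w′ , cong suc e

  suffix : ∀ {x y} (w : Walk R x y) (i : Fin (suc (len w))) →
           Σ[ w′ ∈ Walk R (vertexAt w i) y ] toℕ i + len w′ ≡ len w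
  suffix w zero = w , refl
  suffix (step r w) (suc i) with suffix w i
  ... | w′ , e = w′ , cong suc e

  -- a walk with at least n arcs repeats a vertex (pigeonhole); cut out the cycle in between
  shorten : ∀ {x y} (w : Walk R x y) → n < suc (len w) → Σ[ w′ ∈ Walk R x y ] len w′ < len w
  shorten w n<1+len with pigeonhole n<1+len (vertexAt w)
  ... | i , j , i<j , same with prefix w i | suffix w j
  ...   | wᵢ , |wᵢ| | wⱼ , |wⱼ| = wᵢ ++ʷ cast (sym same) refl wⱼ , shorter
    where
    open ≤-Reasoning
    shorter : len (wᵢ ++ʷ cast (sym same) refl wⱼ) < len w
    shorter = begin-strict
      len (wᵢ ++ʷ cast (sym same) refl wⱼ)   ≡⟨ len-++ʷ wᵢ _ ⟩
      len wᵢ + len (cast (sym same) refl wⱼ) ≡⟨ cong₂ _+_ |wᵢ| (len-cast (sym same) refl wⱼ) ⟩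
      toℕ i + len wⱼ                         <⟨ +-monoˡ-< (len wⱼ) i<j ⟩
      toℕ j + len wⱼ                         ≡⟨ |wⱼ| ⟩
      len w                                  ∎

  walk≤? : ∀ k x y → Dec (Σ[ w ∈ Walk R x y ] len w ≤ k)
  walk≤? k x y with x ≟ y
  ... | yes refl = yes ([] , z≤n)
  walk≤? zero x y | no x≢y = no λ { ([] , _) → x≢y refl }
  walk≤? (suc k) x y | no x≢y =
    map′ (λ (_ , r , w , w≤k) → step r w , s≤s w≤k) first-step
         (any? λ z → R x z Bool.≟ true ×-dec walk≤? k z y)
    where
    first-step : Σ[ w ∈ Walk R x y ] len w ≤ suc k →
                 ∃ λ z → R x z ≡ true × Σ[ w ∈ Walk R z y ] len w ≤ k
    first-step ([] , _) = ⊥-elim (x≢y refl)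
    first-step (step r w , s≤s w≤k) = _ , r , w , w≤k

  shortest : ∀ {x y} → Walk R x y → Σ (Walk R x y) Shortest
  shortest {x} {y} w = descend (len w) w ≤-refl
    where
    descend : ∀ k (w : Walk R x y) → len w ≤ k → Σ (Walk R x y) Shortest
    descend zero w w≤0 = w , λ _ → ≤-trans w≤0 z≤n
    descend (suc k) w w≤1+k with walk≤? k x y
    ... | yes (w′ , w′≤k) = descend k w′ w′≤k
    ... | no ∄shorter =
      w , λ w′ → ≮⇒≥ λ w′<w → ∄shorter (w′ , ≤-pred (≤-trans w′<w w≤1+k))

  shortest-len< : ∀ {x y} {w : Walk R x y} → Shortest w → len w < n
  shortest-len< {w = w} sh with len w ℕ.<? n
  ... | yes w<n = w<n
  ... | no w≮n = let w′ , w′<w = shorten w (s≤s (≮⇒≥ w≮n)) in ⊥-elim (<⇒≱ w′<w (sh w′))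

  walk? : ∀ x y → Dec (Walk R x y)
  walk? x y = map′ proj₁ (λ w → within-bound (shortest w)) (walk≤? (pred n) x y)
    where
    within-bound : Σ (Walk R x y) Shortest → Σ[ w ∈ Walk R x y ] len w ≤ pred n
    within-bound (w , sh) = w , <⇒≤pred (shortest-len< sh)

-- Deciding monitoring

module _ {n : ℕ} {R : BoolRel n} (u v : Fin n) where

  traverses-all≤? : ∀ k x y → Dec (∀ (w : Walk R x y) → len w ≤ k → Traverses u v w)
  traverses-all≤? k x y with x ≟ y
  ... | yes refl = no λ all → untraversed (all [] z≤n)
    where untraversed : ¬ Traverses u v {x} {x} []
          untraversed ()
  traverses-all≤? zero x y | no x≢y = yes λ { [] _ → ⊥-elim (x≢y refl) }
  traverses-all≤? (suc k) x y | no x≢y =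
    map′ from-first-arcs to-first-arcs
         (all? λ z → R x z Bool.≟ true →-dec ((x ≟ u ×-dec z ≟ v) ⊎-dec traverses-all≤? k z y))
    where
    FirstArc : Fin n → Set
    FirstArc z = R x z ≡ true →
                 (x ≡ u × z ≡ v) ⊎ (∀ (w : Walk R z y) → len w ≤ k → Traverses u v w)
    from-first-arcs : (∀ z → FirstArc z) → ∀ (w : Walk R x y) → len w ≤ suc k → Traverses u v w
    from-first-arcs all [] _ = ⊥-elim (x≢y refl)
    from-first-arcs all (step {z = z} r w) (s≤s w≤k) with all z r
    ... | inj₁ (refl , refl) = here r w
    ... | inj₂ all′ = there r (all′ w w≤k)
    to-first-arcs : (∀ (w : Walk R x y) → len w ≤ suc k → Traverses u v w) → ∀ z → FirstArc z
    to-first-arcs all z r with x ≟ u ×-dec z ≟ v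
    ... | yes first = inj₁ first
    ... | no ¬first = inj₂ λ w w≤k →
                        fromInj₂ (⊥-elim ∘ ¬first) (traverses-step (all (step r w) (s≤s w≤k)))

  monitors? : ∀ x y → Dec (Monitors R x y u v)
  monitors? x y with walk? {R = R} x y
  ... | no ∄w = no (∄w ∘ proj₁)
  ... | yes w = let ws , ws-shortest = shortest w in
    map′ (λ all → w , λ w′ sh → all w′ (sh ws))
         (λ (_ , all) w′ w′≤ws → all w′ λ w″ → ≤-trans w′≤ws (ws-shortest w″))
         (traverses-all≤? (len ws) x y)

_∷ʳ_ : Walk R x y → R y z ≡ true → Walk R x z
[] ∷ʳ r = step r []
step r′ w ∷ʳ r = step r′ (w ∷ʳ r)

len-∷ʳ : (w : Walk R x y) (r : R y z ≡ true) → len (w ∷ʳ r) ≡ suc (len w)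
len-∷ʳ [] r = refl
len-∷ʳ (step r′ w) r = cong suc (len-∷ʳ w r)

traverses-∷ʳ : (w : Walk R x y) (r : R y z ≡ true) →
               Traverses u v (w ∷ʳ r) → Traverses u v w ⊎ (u ≡ y × v ≡ z)
traverses-∷ʳ [] r (here _ _) = inj₂ (refl , refl)
traverses-∷ʳ (step r′ w) r (here _ _) = inj₁ (here r′ w)
traverses-∷ʳ (step r′ w) r (there _ t) = map₁ (there r′) (traverses-∷ʳ w r t)

reverse : Walk R x y → Walk (flip R) y x
reverse [] = []
reverse (step r w) = reverse w ∷ʳ r

len-reverse : (w : Walk R x y) → len (reverse w) ≡ len w
len-reverse [] = refl
len-reverse (step r w) = trans (len-∷ʳ (reverse w) r) (cong suc (len-reverse w))

traverses-reverse : (w : Walk R x y) → Traverses v u (reverse w) → Traverses u v w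
traverses-reverse (step r w) t with traverses-∷ʳ (reverse w) r t
... | inj₁ t′ = there r (traverses-reverse w t′)
... | inj₂ (refl , refl) = here r w

reverse-shortest : {w : Walk R x y} → Shortest w → Shortest (reverse w)
reverse-shortest {w = w} sh w′ = subst₂ _≤_ (sym (len-reverse w)) (len-reverse w′) (sh (reverse w′))

monitors-reverse : Monitors R x y u v → Monitors (flip R) y x v u
monitors-reverse {R = R} (w , all) =
  reverse w , λ w′ sh → traverses-reverse w′ (all (reverse w′) (reverse-shortest {R = flip R} sh))

-- Pendant vertices

SoleSucc : BoolRel n → Fin n → Fin n → Set
SoleSucc R ℓ h = ∀ z → R ℓ z ≡ true → z ≡ h

SolePred : BoolRel n → Fin n → Fin n → Set
SolePred R ℓ h = ∀ z → R z ℓ ≡ true → z ≡ h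

Pendant : BoolRel n → Fin n → Fin n → Set
Pendant R ℓ h = SoleSucc R ℓ h × SolePred R ℓ h

module _ {n : ℕ} {R : BoolRel n} {ℓ h : Fin n} where

  sole-pred-of-sym : (∀ u v → R u v ≡ R v u) → SoleSucc R ℓ h → SolePred R ℓ h
  sole-pred-of-sym R-sym succ z e = succ z (trans (R-sym ℓ z) e)

  pendant-sub : ∀ {R′ : BoolRel n} → (∀ u v → R′ u v ≡ true → R u v ≡ true) →
                Pendant R ℓ h → Pendant R′ ℓ h
  pendant-sub R′⊆R (succ , pred) = (λ z → succ z ∘ R′⊆R ℓ z) , (λ z → pred z ∘ R′⊆R z ℓ)

  leaving-traverses : SoleSucc R ℓ h → ∀ {y} → y ≢ ℓ → (w : Walk R ℓ y) → Traverses ℓ h w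
  leaving-traverses succ y≢ℓ [] = ⊥-elim (y≢ℓ refl)
  leaving-traverses succ y≢ℓ (step {z = z} r w) with succ z r
  ... | refl = here r w

  monitors-leaving-arc : SoleSucc R ℓ h → ∀ {y} → y ≢ ℓ → Walk R ℓ y → Monitors R ℓ y ℓ h
  monitors-leaving-arc succ y≢ℓ w = w , λ w′ _ → leaving-traverses succ y≢ℓ w′

  shortest-no-return : SoleSucc R ℓ h → ∀ {y} (r : R h ℓ ≡ true) (w : Walk R ℓ y) →
                       Shortest (step r w) → y ≡ ℓ
  shortest-no-return succ r [] _ = refl
  shortest-no-return succ r (step {z = z} r′ w) sh with succ z r′
  ... | refl = ⊥-elim (1+n≰n (≤-trans (n≤1+n _) (sh w)))

  shortest-entering-ends : SoleSucc R ℓ h → ∀ {x y} {w : Walk R x y} →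
                           Shortest w → Traverses h ℓ w → y ≡ ℓ
  shortest-entering-ends succ sh (here r w) = shortest-no-return succ r w sh
  shortest-entering-ends succ sh (there r {w} t) = shortest-entering-ends succ (shortest-tail r w sh) t

  shortest-leaving-starts : Pendant R ℓ h → ∀ {x y} {w : Walk R x y} →
                            Shortest w → Traverses ℓ h w → x ≡ ℓ
  shortest-leaving-starts _ sh (here _ _) = refl
  -- otherwise the walk enters ℓ from h just before, so it ends at ℓ and its tail is a loop
  shortest-leaving-starts (succ , pred) {x} sh (there r {w} t)
    with shortest-leaving-starts (succ , pred) (shortest-tail r w sh) t
  ... | refl with pred x r
  ...   | refl with shortest-no-return succ r w sh
  ...     | refl = ⊥-elim (nonempty-loop (shortest-tail r w sh) t)
    where
    nonempty-loop : ∀ {w : Walk R ℓ ℓ} → Shortest w → ¬ Traverses ℓ h w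
    nonempty-loop sh t with sh []
    nonempty-loop sh (here _ _) | ()
    nonempty-loop sh (there _ _) | ()

  monitored-entering-ends : Pendant R ℓ h → ∀ {x y} → Monitors R x y h ℓ → y ≡ ℓ
  monitored-entering-ends (succ , _) (w , all) =
    let ws , sh = shortest w in shortest-entering-ends succ sh (all ws sh)

  monitored-leaving-starts : Pendant R ℓ h → ∀ {x y} → Monitors R x y ℓ h → x ≡ ℓ
  monitored-leaving-starts pend (w , all) =
    let ws , sh = shortest w in shortest-leaving-starts pend sh (all ws sh)

  monitors-shift-start : SoleSucc R ℓ h → ∀ {y u v} → y ≢ ℓ → u ≢ ℓ →
                         Monitors R ℓ y u v → Monitors R h y u v
  monitors-shift-start succ y≢ℓ u≢ℓ ([] , _) = ⊥-elim (y≢ℓ refl)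
  monitors-shift-start succ {y} {u} {v} y≢ℓ u≢ℓ (step {z = z} r w , all) with succ z r
  ... | refl = w , λ w′ sh → drop-first (all (step r w′) (prepend-shortest sh))
    where
    prepend-shortest : ∀ {w′ : Walk R h y} → Shortest w′ → Shortest (step r w′)
    prepend-shortest sh [] = ⊥-elim (y≢ℓ refl)
    prepend-shortest sh (step {z = z′} r′ w″) with succ z′ r′
    ... | refl = s≤s (sh w″)
    drop-first : ∀ {w′ : Walk R h y} → Traverses u v (step r w′) → Traverses u v w′
    drop-first (here _ _) = ⊥-elim (u≢ℓ refl)
    drop-first (there _ t) = t

  monitors-unshift-start : SoleSucc R ℓ h → R ℓ h ≡ true → ∀ {y u v} → y ≢ ℓ →
                           Monitors R h y u v → Monitors R ℓ y u v
  monitors-unshift-start succ r y≢ℓ (w , all) = step r w , through-h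
    where
    through-h : ∀ w′ → Shortest w′ → Traverses _ _ w′
    through-h [] _ = ⊥-elim (y≢ℓ refl)
    through-h (step {z = z} r′ w′) sh with succ z r′
    ... | refl = there r′ (all w′ (shortest-tail r′ w′ sh))

monitors-shift-end : SolePred R ℓ h → x ≢ ℓ → v ≢ ℓ → Monitors R x ℓ u v → Monitors R x h u v
monitors-shift-end {R = R} pred x≢ℓ v≢ℓ =
  monitors-reverse {R = flip R} ∘ monitors-shift-start {R = flip R} pred x≢ℓ v≢ℓ ∘ monitors-reverse

LeafOf : Graph n → Fin n → Fin n → Set
LeafOf G ℓ h = adj G h ℓ ≡ true × Pendant (adj G) ℓ h

module _ {n : ℕ} {G : Graph n} {M : Subset n} {ℓ h : Fin n} where

  leaf-in-MEG-set : LeafOf G ℓ h → IsMEGSet G M → ℓ ∈ M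
  leaf-in-MEG-set (edge , pend) isM with isM h ℓ edge
  ... | _ , _ , x∈M , y∈M , w , all with shortest w
  ...   | ws , sh with all ws sh
  ...     | inj₁ h→ℓ = subst (_∈ M) (shortest-entering-ends (proj₁ pend) sh h→ℓ) y∈M
  ...     | inj₂ ℓ→h = subst (_∈ M) (shortest-leaving-starts pend sh ℓ→h) x∈M

  leaf-in-MAG-set : (O : Orientation G) → LeafOf G ℓ h → IsMAGSet O M → ℓ ∈ M
  leaf-in-MAG-set O (edge , pend) isM = [ entering , leaving ]′ (edge-arc O h ℓ edge)
    where
    pend′ : Pendant (arc O) ℓ h
    pend′ = pendant-sub (arc-edge O) pend
    entering : arc O h ℓ ≡ true → ℓ ∈ M
    entering h→ℓ with isM h ℓ h→ℓ
    ... | _ , _ , _ , y∈M , _ , inj₁ m = subst (_∈ M) (monitored-entering-ends pend′ m) y∈M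
    ... | _ , _ , x∈M , _ , _ , inj₂ m = subst (_∈ M) (monitored-entering-ends pend′ m) x∈M
    leaving : arc O ℓ h ≡ true → ℓ ∈ M
    leaving ℓ→h with isM ℓ h ℓ→h
    ... | _ , _ , x∈M , _ , _ , inj₁ m = subst (_∈ M) (monitored-leaving-starts pend′ m) x∈M
    ... | _ , _ , _ , y∈M , _ , inj₂ m = subst (_∈ M) (monitored-leaving-starts pend′ m) y∈M

-- Retractions

record Retraction {m n} (R : BoolRel n) (S : BoolRel m) : Set where
  field
    embed            : Fin m → Fin n
    contract         : Fin n → Fin m
    contract-embed   : ∀ a → contract (embed a) ≡ a
    restricts        : ∀ a b → R (embed a) (embed b) ≡ S a b
    collapse-or-core : ∀ {p q} → R p q ≡ true →
                       contract p ≡ contract q ⊎ (p ≡ embed (contract p) × q ≡ embed (contract q))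

module _ {m n} {R : BoolRel n} {S : BoolRel m} (ρ : Retraction R S) where
  open Retraction ρ

  embed-injective : ∀ {a b} → embed a ≡ embed b → a ≡ b
  embed-injective {a} {b} e = trans (sym (contract-embed a)) (trans (cong contract e) (contract-embed b))

  embed-walk : ∀ {a b} → Walk S a b → Walk R (embed a) (embed b)
  embed-walk [] = []
  embed-walk (step s w) = step (trans (restricts _ _) s) (embed-walk w)

  len-embed-walk : ∀ {a b} (w : Walk S a b) → len (embed-walk w) ≡ len w
  len-embed-walk [] = refl
  len-embed-walk (step s w) = cong suc (len-embed-walk w)

  traverses-embed-walk : ∀ {a b u v p q} (w : Walk S a b) → Traverses p q (embed-walk w) →
                         p ≡ embed u → q ≡ embed v → Traverses u v w
  traverses-embed-walk (step s w) (here _ _) p≡ q≡ with embed-injective p≡ | embed-injective q≡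
  ... | refl | refl = here s w
  traverses-embed-walk (step s w) (there _ t) p≡ q≡ = there s (traverses-embed-walk w t p≡ q≡)

  contract-walk : ∀ {p q} → Walk R p q → Walk S (contract p) (contract q)
  contract-walk [] = []
  contract-walk (step r w) with collapse-or-core r
  ... | inj₁ same = cast (sym same) refl (contract-walk w)
  ... | inj₂ (p≡ , z≡) =
    step (trans (sym (restricts _ _)) (subst₂ (λ s t → R s t ≡ true) p≡ z≡ r)) (contract-walk w)

  len-contract-walk : ∀ {p q} (w : Walk R p q) → len (contract-walk w) ≤ len w
  len-contract-walk [] = z≤n
  len-contract-walk (step r w) with collapse-or-core r
  ... | inj₁ same =
    ≤-trans (≤-reflexive (len-cast (sym same) refl _)) (m≤n⇒m≤1+n (len-contract-walk w))
  ... | inj₂ _ = s≤s (len-contract-walk w)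

  traverses-contract-walk : ∀ {p q u v} (w : Walk R p q) → Traverses u v (contract-walk w) →
                            Traverses (embed u) (embed v) w
  traverses-contract-walk (step r w) t with collapse-or-core r
  ... | inj₁ same = there r (traverses-contract-walk w (traverses-cast (sym same) refl t))
  traverses-contract-walk (step r w) (here _ _) | inj₂ (p≡ , z≡) =
    subst₂ (λ s t → Traverses s t (step r w)) p≡ z≡ (here r w)
  traverses-contract-walk (step r w) (there _ t) | inj₂ _ = there r (traverses-contract-walk w t)

  pull : ∀ {a b} → Walk R (embed a) (embed b) → Walk S a b
  pull {a} {b} w = cast (contract-embed a) (contract-embed b) (contract-walk w)

  len-pull : ∀ {a b} (w : Walk R (embed a) (embed b)) → len (pull w) ≤ len w
  len-pull {a} {b} w =
    ≤-trans (≤-reflexive (len-cast (contract-embed a) (contract-embed b) _)) (len-contract-walk w)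

  embed-shortest : ∀ {a b} {w : Walk S a b} → Shortest w → Shortest (embed-walk w)
  embed-shortest {w = w} sh w′ =
    ≤-trans (≤-reflexive (len-embed-walk w)) (≤-trans (sh (pull w′)) (len-pull w′))

  pull-shortest : ∀ {a b} {w : Walk R (embed a) (embed b)} → Shortest w → Shortest (pull w)
  pull-shortest {w = w} sh w′ =
    ≤-trans (len-pull w) (≤-trans (sh (embed-walk w′)) (≤-reflexive (len-embed-walk w′)))

  monitors-embed⇔ : ∀ {a b u v} → Monitors R (embed a) (embed b) (embed u) (embed v) ⇔ Monitors S a b u v
  monitors-embed⇔ = mk⇔
    (λ (w , all) → pull w , λ w′ sh →
       traverses-embed-walk w′ (all (embed-walk w′) (embed-shortest sh)) refl refl)
    (λ (w , all) → embed-walk w , λ w′ sh →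
       traverses-contract-walk w′
         (traverses-cast (contract-embed _) (contract-embed _) (all (pull w′) (pull-shortest sh))))

-- for u < v, β u v says whether the edge {u, v} points from u to v
orientBy : ∀ {m} → Graph m → BoolRel m → BoolRel m
orientBy H β u v = adj H u v ∧ (if toℕ u <ᵇ toℕ v then β u v else not (β v u))

module _ {m} {H : Graph m} (O : Orientation H) where

  arc-non-edge : ∀ u v → adj H u v ≡ false → arc O u v ≡ false
  arc-non-edge u v e with arc O u v in r
  ... | false = refl
  ... | true with trans (sym e) (arc-edge O u v r)
  ...   | ()

  arc-reverse : ∀ u v → adj H u v ≡ true → arc O u v ≡ not (arc O v u)
  arc-reverse u v e with arc O v u in r
  ... | true = antisym O v u r
  ... | false with edge-arc O u v e
  ...   | inj₁ uv = uv
  ...   | inj₂ vu with trans (sym r) vu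
  ...     | ()

  orientBy-arc : ∀ u v → arc O u v ≡ orientBy H (arc O) u v
  orientBy-arc u v with adj H u v in e
  ... | false = arc-non-edge u v e
  ... | true with toℕ u <ᵇ toℕ v
  ...   | true = refl
  ...   | false = arc-reverse u v e

orientBy-cong : ∀ {m} (H : Graph m) {β β′ : BoolRel m} →
                (∀ u v → toℕ u < toℕ v → adj H u v ≡ true → β u v ≡ β′ u v) →
                ∀ u v → orientBy H β u v ≡ orientBy H β′ u v
orientBy-cong H β≗β′ u v with adj H u v in e
... | false = refl
... | true with toℕ u <ᵇ toℕ v in lt
...   | true = cong (true ∧_) (β≗β′ u v (ℕ.<ᵇ⇒< (toℕ u) (toℕ v) (subst T (sym lt) _)) e)
...   | false = cong (λ b → true ∧ not b) (β≗β′ v u v<u (trans (Graph.sym H v u) e))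
  where
  u≢v : u ≢ v
  u≢v refl with trans (sym (irrefl H u)) e
  ... | ()
  v<u : toℕ v < toℕ u
  v<u = ≤∧≢⇒< (ℕ.≮⇒≥ λ u<v → subst T lt (ℕ.<⇒<ᵇ u<v)) (u≢v ∘ sym)

-- Attaching leaves to a graph

∈-++ˡ : ∀ {m j x} {p : Subset m} {q : Subset j} → x ∈ p → x ↑ˡ j ∈ p ++ q
∈-++ˡ here = here
∈-++ˡ (there x∈p) = there (∈-++ˡ x∈p)

∈-++ʳ : ∀ {m j x} (p : Subset m) {q : Subset j} → x ∈ q → m ↑ʳ x ∈ p ++ q
∈-++ʳ [] x∈q = x∈q
∈-++ʳ (_ ∷ p) x∈q = there (∈-++ʳ p x∈q)

module PendantExtension {m : ℕ} (H : Graph m) (hub : Fin m) (j : ℕ) where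

  core : Fin m → Fin (m + j)
  core a = a ↑ˡ j

  leaf : Fin j → Fin (m + j)
  leaf i = m ↑ʳ i

  data View : Fin (m + j) → Set where
    core-view : ∀ a → View (core a)
    leaf-view : ∀ i → View (leaf i)

  view : ∀ p → View p
  view p with splitAt m p in eq
  ... | inj₁ a = subst View (splitAt⁻¹-↑ˡ eq) (core-view a)
  ... | inj₂ i = subst View (splitAt⁻¹-↑ʳ eq) (leaf-view i)

  core≢leaf : ∀ {a i} → core a ≢ leaf i
  core≢leaf {a} {i} e with trans (sym (splitAt-↑ˡ m a j)) (trans (cong (splitAt m) e) (splitAt-↑ʳ m j i))
  ... | ()

  adjacency : Fin m ⊎ Fin j → Fin m ⊎ Fin j → Bool
  adjacency (inj₁ a) (inj₁ b) = adj H a b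
  adjacency (inj₁ a) (inj₂ _) = does (a ≟ hub)
  adjacency (inj₂ _) (inj₁ b) = does (b ≟ hub)
  adjacency (inj₂ _) (inj₂ _) = false

  adjacency-sym : ∀ s t → adjacency s t ≡ adjacency t s
  adjacency-sym (inj₁ a) (inj₁ b) = Graph.sym H a b
  adjacency-sym (inj₁ _) (inj₂ _) = refl
  adjacency-sym (inj₂ _) (inj₁ _) = refl
  adjacency-sym (inj₂ _) (inj₂ _) = refl

  adjacency-irrefl : ∀ s → adjacency s s ≡ false
  adjacency-irrefl (inj₁ a) = irrefl H a
  adjacency-irrefl (inj₂ _) = refl

  graph : Graph (m + j)
  graph = record
    { adj    = λ p q → adjacency (splitAt m p) (splitAt m q)
    ; sym    = λ p q → adjacency-sym (splitAt m p) (splitAt m q)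
    ; irrefl = λ p → adjacency-irrefl (splitAt m p)
    }

  adj-core-core : ∀ a b → adj graph (core a) (core b) ≡ adj H a b
  adj-core-core a b rewrite splitAt-↑ˡ m a j | splitAt-↑ˡ m b j = refl

  adj-core-leaf : ∀ a i → adj graph (core a) (leaf i) ≡ does (a ≟ hub)
  adj-core-leaf a i rewrite splitAt-↑ˡ m a j | splitAt-↑ʳ m j i = refl

  leaves-nonadjacent : ∀ i k → adj graph (leaf i) (leaf k) ≢ true
  leaves-nonadjacent i k e rewrite splitAt-↑ʳ m j i | splitAt-↑ʳ m j k with e
  ... | ()

  hub-leaf : ∀ i → adj graph (core hub) (leaf i) ≡ true
  hub-leaf i = trans (adj-core-leaf hub i) (dec-true (hub ≟ hub) refl)

  adjacent-to-leaf : ∀ {a i} → adj graph (core a) (leaf i) ≡ true → a ≡ hub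
  adjacent-to-leaf {a} {i} e rewrite adj-core-leaf a i with a ≟ hub
  ... | yes a≡hub = a≡hub

  adjacent-from-leaf : ∀ {i b} → adj graph (leaf i) (core b) ≡ true → b ≡ hub
  adjacent-from-leaf {i} {b} e = adjacent-to-leaf (trans (Graph.sym graph (core b) (leaf i)) e)

  leaf-pendant : ∀ i → Pendant (adj graph) (leaf i) (core hub)
  leaf-pendant i = sole-succ , sole-pred-of-sym (Graph.sym graph) sole-succ
    where
    sole-succ : SoleSucc (adj graph) (leaf i) (core hub)
    sole-succ z e with view z
    ... | core-view b = cong core (adjacent-from-leaf e)
    ... | leaf-view k = ⊥-elim (leaves-nonadjacent i k e)

  core-pendant : ∀ {a b} → Pendant (adj H) a b → a ≢ hub → Pendant (adj graph) (core a) (core b)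
  core-pendant {a} {b} (succ , _) a≢hub = sole-succ , sole-pred-of-sym (Graph.sym graph) sole-succ
    where
    sole-succ : SoleSucc (adj graph) (core a) (core b)
    sole-succ z e with view z
    ... | core-view c = cong core (succ c (trans (sym (adj-core-core a c)) e))
    ... | leaf-view i = ⊥-elim (a≢hub (adjacent-to-leaf e))

  contract : Fin (m + j) → Fin m
  contract p = [ id , const hub ]′ (splitAt m p)

  contract-core : ∀ a → contract (core a) ≡ a
  contract-core a rewrite splitAt-↑ˡ m a j = refl

  contract-leaf : ∀ i → contract (leaf i) ≡ hub
  contract-leaf i rewrite splitAt-↑ʳ m j i = refl

  retraction : {R : BoolRel (m + j)} {S : BoolRel m} →
               (∀ p q → R p q ≡ true → adj graph p q ≡ true) →
               (∀ a b → R (core a) (core b) ≡ S a b) → Retraction R S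
  retraction R⊆adj restricts = record
    { embed = core ; contract = contract ; contract-embed = contract-core ; restricts = restricts
    ; collapse-or-core = λ {p} {q} r → collapse-or-core p q (R⊆adj p q r) }
    where
    collapse-or-core : ∀ p q → adj graph p q ≡ true →
                       contract p ≡ contract q ⊎ (p ≡ core (contract p) × q ≡ core (contract q))
    collapse-or-core p q e with view p | view q
    ... | core-view a | core-view b =
      inj₂ (cong core (sym (contract-core a)) , cong core (sym (contract-core b)))
    ... | core-view a | leaf-view i =
      inj₁ (trans (contract-core a) (trans (adjacent-to-leaf e) (sym (contract-leaf i))))
    ... | leaf-view i | core-view b =
      inj₁ (trans (contract-leaf i) (trans (sym (adjacent-from-leaf e)) (sym (contract-core b))))
    ... | leaf-view i | leaf-view k = ⊥-elim (leaves-nonadjacent i k e)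

  connected : Connected H → Connected graph
  connected H-connected p q = to-hub p ++ʷ from-hub q
    where
    lift : ∀ {a b} → Walk (adj H) a b → Walk (adj graph) (core a) (core b)
    lift = embed-walk (retraction (λ _ _ e → e) adj-core-core)
    to-hub : ∀ p → Walk (adj graph) p (core hub)
    to-hub p with view p
    ... | core-view a = lift (H-connected a hub)
    ... | leaf-view i = step (trans (Graph.sym graph (leaf i) (core hub)) (hub-leaf i)) []
    from-hub : ∀ q → Walk (adj graph) (core hub) q
    from-hub q with view q
    ... | core-view a = lift (H-connected hub a)
    ... | leaf-view i = step (hub-leaf i) []

  restrict : Orientation graph → Orientation H
  restrict O = record
    { arc      = λ a b → arc O (core a) (core b)
    ; arc-edge = λ a b r → trans (sym (adj-core-core a b)) (arc-edge O _ _ r)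
    ; edge-arc = λ a b e → edge-arc O _ _ (trans (adj-core-core a b) e)
    ; antisym  = λ a b → antisym O _ _
    }

  module _ (O : Orientation H) where

    inwardArcs : Fin m ⊎ Fin j → Fin m ⊎ Fin j → Bool
    inwardArcs (inj₁ a) (inj₁ b) = arc O a b
    inwardArcs (inj₂ _) (inj₁ b) = does (b ≟ hub)
    inwardArcs _        _        = false

    inwardArcs-edge : ∀ s t → inwardArcs s t ≡ true → adjacency s t ≡ true
    inwardArcs-edge (inj₁ a) (inj₁ b) = arc-edge O a b
    inwardArcs-edge (inj₂ _) (inj₁ _) r = r

    edge-inwardArcs : ∀ s t → adjacency s t ≡ true → inwardArcs s t ≡ true ⊎ inwardArcs t s ≡ true
    edge-inwardArcs (inj₁ a) (inj₁ b) = edge-arc O a b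
    edge-inwardArcs (inj₁ _) (inj₂ _) = inj₂
    edge-inwardArcs (inj₂ _) (inj₁ _) = inj₁

    inwardArcs-antisym : ∀ s t → inwardArcs s t ≡ true → inwardArcs t s ≡ false
    inwardArcs-antisym (inj₁ a) (inj₁ b) = antisym O a b
    inwardArcs-antisym (inj₂ _) (inj₁ _) _ = refl

    extendInward : Orientation graph
    extendInward = record
      { arc      = λ p q → inwardArcs (splitAt m p) (splitAt m q)
      ; arc-edge = λ p q → inwardArcs-edge (splitAt m p) (splitAt m q)
      ; edge-arc = λ p q → edge-inwardArcs (splitAt m p) (splitAt m q)
      ; antisym  = λ p q → inwardArcs-antisym (splitAt m p) (splitAt m q)
      }

    extendInward-core-core : ∀ a b → arc extendInward (core a) (core b) ≡ arc O a b
    extendInward-core-core a b rewrite splitAt-↑ˡ m a j | splitAt-↑ˡ m b j = refl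

    extendInward-core-leaf : ∀ a i → arc extendInward (core a) (leaf i) ≡ false
    extendInward-core-leaf a i rewrite splitAt-↑ˡ m a j | splitAt-↑ʳ m j i = refl

    extendInward-leaf-hub : ∀ i → arc extendInward (leaf i) (core hub) ≡ true
    extendInward-leaf-hub i rewrite splitAt-↑ʳ m j i | splitAt-↑ˡ m hub j = dec-true (hub ≟ hub) refl

-- The net

pattern t₀ = zero
pattern t₁ = suc zero
pattern t₂ = suc (suc zero)
pattern s₀ = suc (suc (suc zero))
pattern s₁ = suc (suc (suc (suc zero)))
pattern s₂ = suc (suc (suc (suc (suc zero))))

edge : Fin 6 → Fin 6 × Fin 6
edge = lookup ((t₀ , t₁) ∷ (t₀ , t₂) ∷ (t₁ , t₂) ∷ (t₀ , s₀) ∷ (t₁ , s₁) ∷ (t₂ , s₂) ∷ [])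

-- the position of an edge in the list above; junk value 0 on non-edges
edgeIndex : Fin 6 → Fin 6 → Fin 6
edgeIndex t₀ t₁ = # 0
edgeIndex t₀ t₂ = # 1
edgeIndex t₁ t₂ = # 2
edgeIndex t₀ s₀ = # 3
edgeIndex t₁ s₁ = # 4
edgeIndex t₂ s₂ = # 5
edgeIndex _  _  = # 0

isEdge : Fin 6 → Fin 6 → Bool
isEdge u v = does (≡-dec _≟_ _≟_ (edge (edgeIndex u v)) (u , v))

net : Graph 6
net = record
  { adj    = λ u v → isEdge u v ∨ isEdge v u
  ; sym    = λ u v → Bool.∨-comm (isEdge u v) (isEdge v u)
  ; irrefl = from-yes (all? λ u → isEdge u u ∨ isEdge u u Bool.≟ false)
  }

net-connected : Connected net
net-connected = from-yes (all? λ x → all? λ y → walk? {R = adj net} x y)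

s₁-pendant : Pendant (adj net) s₁ t₁
s₁-pendant = sole-succ , sole-pred-of-sym (Graph.sym net) sole-succ
  where
  sole-succ : SoleSucc (adj net) s₁ t₁
  sole-succ = from-yes (all? λ z → adj net s₁ z Bool.≟ true →-dec z ≟ t₁)

s₂-pendant : Pendant (adj net) s₂ t₂
s₂-pendant = sole-succ , sole-pred-of-sym (Graph.sym net) sole-succ
  where
  sole-succ : SoleSucc (adj net) s₂ t₂
  sole-succ = from-yes (all? λ z → adj net s₂ z Bool.≟ true →-dec z ≟ t₂)

edge-edgeIndex : ∀ u v → toℕ u < toℕ v → adj net u v ≡ true → edge (edgeIndex u v) ≡ (u , v)
edge-edgeIndex = from-yes (all? λ u → all? λ v → toℕ u ℕ.<? toℕ v →-dec
  (adj net u v Bool.≟ true →-dec ≡-dec _≟_ _≟_ (edge (edgeIndex u v)) (u , v)))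

orient : Vec Bool 6 → BoolRel 6
orient b = orientBy net λ u v → lookup b (edgeIndex u v)

directions : Orientation net → Vec Bool 6
directions O = tabulate (uncurry (arc O) ∘ edge)

orient-directions : (O : Orientation net) → ∀ u v → arc O u v ≡ orient (directions O) u v
orient-directions O u v = trans (orientBy-arc O u v) (orientBy-cong net listed u v)
  where
  listed : ∀ u v → toℕ u < toℕ v → adj net u v ≡ true →
           arc O u v ≡ lookup (directions O) (edgeIndex u v)
  listed u v u<v e = sym (trans (lookup∘tabulate (uncurry (arc O) ∘ edge) (edgeIndex u v))
                                (cong (uncurry (arc O)) (edge-edgeIndex u v u<v e)))

OnTriangle : Fin 6 → Set
OnTriangle a = toℕ a < 3

onTriangle? : ∀ a → Dec (OnTriangle a)
onTriangle? a = toℕ a ℕ.<? 3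

s₀-off-triangle : ¬ OnTriangle s₀
s₀-off-triangle (s≤s (s≤s (s≤s ())))

Blind : BoolRel 6 → Fin 6 → Fin 6 → Set
Blind S u v = ∀ a b → ¬ OnTriangle a → ¬ OnTriangle b → ¬ Monitors S a b u v

HasBlindArc : BoolRel 6 → Set
HasBlindArc S = ∃₂ λ u v → S u v ≡ true × Blind S u v

hasBlindArc? : ∀ S → Dec (HasBlindArc S)
hasBlindArc? S = any? λ u → any? λ v → S u v Bool.≟ true ×-dec
  all? λ a → all? λ b → ¬? (onTriangle? a) →-dec (¬? (onTriangle? b) →-dec ¬? (monitors? u v a b))

every-orientation-has-blind-arc : ∀ b → HasBlindArc (orient b)
every-orientation-has-blind-arc b = decidable-stable (hasBlindArc? (orient b)) λ ¬blind →
  toWitnessFalse {a? = anySubset? (¬? ∘ hasBlindArc? ∘ orient)} _ (b , ¬blind)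

-- x ≡ s₀ is allowed because a new leaf at s₀ can take the place of the start vertex s₀
MonitoredFrom : BoolRel 6 → Subset 6 → Fin 6 → Fin 6 → Set
MonitoredFrom S Y u v = ∃₂ λ x y → (x ≡ s₀ ⊎ x ∈ Y) × y ∈ Y × x ≢ y × Monitors S x y u v

monitoredFrom? : ∀ S Y u v → Dec (MonitoredFrom S Y u v)
monitoredFrom? S Y u v = any? λ x → any? λ y →
  (x ≟ s₀ ⊎-dec x ∈? Y) ×-dec y ∈? Y ×-dec ¬? (x ≟ y) ×-dec monitors? u v x y

outerLeaves : Subset 6
outerLeaves = outside ∷ outside ∷ outside ∷ outside ∷ inside ∷ inside ∷ []

net-edges-monitored : ∀ u v → adj net u v ≡ true →
                      MonitoredFrom (adj net) outerLeaves u v ⊎ MonitoredFrom (adj net) outerLeaves v u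
net-edges-monitored = from-yes (all? λ u → all? λ v → adj net u v Bool.≟ true →-dec
  (monitoredFrom? (adj net) outerLeaves u v ⊎-dec monitoredFrom? (adj net) outerLeaves v u))

-- t₀ → t₁ → t₂ → t₀, s₀ → t₀, t₁ → s₁ and s₂ → t₂
cyclic : Vec Bool 6
cyclic = true ∷ false ∷ true ∷ false ∷ true ∷ false ∷ []

cyclicOrientation : Orientation net
cyclicOrientation = record
  { arc      = orient cyclic
  ; arc-edge = from-yes (all? λ u → all? λ v →
                 orient cyclic u v Bool.≟ true →-dec adj net u v Bool.≟ true)
  ; edge-arc = from-yes (all? λ u → all? λ v →
                 adj net u v Bool.≟ true →-dec
                 (orient cyclic u v Bool.≟ true ⊎-dec orient cyclic v u Bool.≟ true))
  ; antisym  = from-yes (all? λ u → all? λ v →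
                 orient cyclic u v Bool.≟ true →-dec orient cyclic v u Bool.≟ false)
  }

cyclicCore : Subset 6
cyclicCore = outside ∷ outside ∷ inside ∷ outside ∷ inside ∷ inside ∷ []

cyclic-arcs-monitored : ∀ u v → orient cyclic u v ≡ true → MonitoredFrom (orient cyclic) cyclicCore u v
cyclic-arcs-monitored = from-yes (all? λ u → all? λ v → orient cyclic u v Bool.≟ true →-dec
  monitoredFrom? (orient cyclic) cyclicCore u v)

-- The net with j leaves attached to s₀

module Construction (j : ℕ) where
  open PendantExtension net s₀ j

  G : Graph (6 + j)
  G = graph

  leafSet : Subset (6 + j)
  leafSet = outerLeaves ++ ⊤

  ∣leafSet∣ : ∣ leafSet ∣ ≡ j + 2
  ∣leafSet∣ = trans (cong (2 +_) (∣⊤∣≡n j)) (+-comm 2 j)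

  leafSet-leaves : ∀ {x} → x ∈ leafSet → ∃ λ h → LeafOf G x h
  leafSet-leaves (there (there (there (there here)))) = core t₁ , refl , core-pendant s₁-pendant λ ()
  leafSet-leaves (there (there (there (there (there here))))) = core t₂ , refl , core-pendant s₂-pendant λ ()
  leafSet-leaves (there (there (there (there (there (there {i = i} _)))))) =
    core s₀ , hub-leaf i , leaf-pendant i

  leafSet⊆ : ∀ {M} → (∀ {ℓ h} → LeafOf G ℓ h → ℓ ∈ M) → ∀ {x} → x ∈ leafSet → x ∈ M
  leafSet⊆ leaves-in-M x∈ = leaves-in-M (proj₂ (leafSet-leaves x∈))

  triangle-∉-leafSet : ∀ a → OnTriangle a → core a ∉ leafSet
  triangle-∉-leafSet = from-yes (all? λ a → onTriangle? a →-dec ¬? (core a ∈? leafSet))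

  meg-lower-bound : ∀ {M} → IsMEGSet G M → j + 2 ≤ ∣ M ∣
  meg-lower-bound {M} isM = subst (_≤ ∣ M ∣) ∣leafSet∣
    (p⊆q⇒∣p∣≤∣q∣ (leafSet⊆ λ leafOf → leaf-in-MEG-set {G = G} leafOf isM))

  module _ (O : Orientation G) {M : Subset (6 + j)} (isM : IsMAGSet O M) where

    S : BoolRel 6
    S = orient (directions (restrict O))

    ρ : Retraction (arc O) S
    ρ = retraction (arc-edge O) (orient-directions (restrict O))

    leaf-pendant-arc : ∀ i → Pendant (arc O) (leaf i) (core s₀)
    leaf-pendant-arc i = pendant-sub (arc-edge O) (leaf-pendant i)

    module _ (no-triangle : ∀ a → OnTriangle a → core a ∉ M) where

      start-off-triangle : ∀ {x y u v} → x ∈ M → y ≢ x → Monitors (arc O) x y (core u) (core v) →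
                           ∃ λ a → ¬ OnTriangle a × Monitors (arc O) (core a) y (core u) (core v)
      start-off-triangle {x} x∈M y≢x m with view x
      ... | core-view a = a , (λ tri → no-triangle a tri x∈M) , m
      ... | leaf-view i =
        s₀ , s₀-off-triangle , monitors-shift-start (proj₁ (leaf-pendant-arc i)) y≢x core≢leaf m

      end-off-triangle : ∀ {a y u v} → y ∈ M → Monitors (arc O) (core a) y (core u) (core v) →
                         ∃ λ b → ¬ OnTriangle b × Monitors (arc O) (core a) (core b) (core u) (core v)
      end-off-triangle {y = y} y∈M m with view y
      ... | core-view b = b , (λ tri → no-triangle b tri y∈M) , m
      ... | leaf-view i =
        s₀ , s₀-off-triangle , monitors-shift-end (proj₂ (leaf-pendant-arc i)) core≢leaf core≢leaf m

      blind-unmonitored : ∀ {x y u v} → Blind S u v → x ∈ M → y ∈ M → y ≢ x →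
                          ¬ Monitors (arc O) x y (core u) (core v)
      blind-unmonitored blind x∈M y∈M y≢x m =
        let a , a-off , m′ = start-off-triangle x∈M y≢x m
            b , b-off , m″ = end-off-triangle y∈M m′
        in blind a b a-off b-off (Equivalence.to (monitors-embed⇔ ρ) m″)

    triangle-vertex : ∃ λ a → OnTriangle a × core a ∈ M
    triangle-vertex = decidable-stable (any? λ a → onTriangle? a ×-dec core a ∈? M) λ ∄a →
      let no-triangle a tri a∈M = ∄a (a , tri , a∈M)
          u , v , uv , blind = every-orientation-has-blind-arc (directions (restrict O))
          uv-in-O = trans (orient-directions (restrict O) u v) uv
          _ , _ , x∈M , y∈M , x≢y , mon = isM (core u) (core v) uv-in-O
      in [ blind-unmonitored no-triangle blind x∈M y∈M (x≢y ∘ sym)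
         , blind-unmonitored no-triangle blind y∈M x∈M x≢y ]′ mon

    mag-lower-bound : suc (j + 2) ≤ ∣ M ∣
    mag-lower-bound =
      let a , tri , a∈M = triangle-vertex
          leafSet⊆M = leafSet⊆ λ leafOf → leaf-in-MAG-set O leafOf isM
      in subst (λ k → suc k ≤ ∣ M ∣) ∣leafSet∣
           (p⊂q⇒∣p∣<∣q∣ (leafSet⊆M , core a , a∈M , triangle-∉-leafSet a tri))

  G-connected : Connected G
  G-connected = connected net-connected

  O⋆ : Orientation G
  O⋆ = extendInward cyclicOrientation

  M⋆ : Subset (6 + j)
  M⋆ = cyclicCore ++ ⊤

  ∣M⋆∣ : ∣ M⋆ ∣ ≡ suc (j + 2)
  ∣M⋆∣ = cong suc ∣leafSet∣

  MonitoredIn : BoolRel (6 + j) → Subset (6 + j) → Fin (6 + j) → Fin (6 + j) → Set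
  MonitoredIn R M u v = ∃₂ λ x y → x ∈ M × y ∈ M × x ≢ y × Monitors R x y u v

  module _ (ℓ₀ : Fin j) where

    lift-monitored : ∀ {R : BoolRel (6 + j)} {S : BoolRel 6} {Y u v} →
      (∀ p q → R p q ≡ true → adj G p q ≡ true) → (∀ a b → R (core a) (core b) ≡ S a b) →
      R (leaf ℓ₀) (core s₀) ≡ true → MonitoredFrom S Y u v → MonitoredIn R (Y ++ ⊤) (core u) (core v)
    lift-monitored {Y = Y} R⊆G restricts r (_ , y , inj₁ refl , y∈Y , _ , m) =
      leaf ℓ₀ , core y , ∈-++ʳ Y ∈⊤ , ∈-++ˡ y∈Y , core≢leaf ∘ sym ,
      monitors-unshift-start (proj₁ (pendant-sub R⊆G (leaf-pendant ℓ₀))) r core≢leaf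
        (Equivalence.from (monitors-embed⇔ (retraction R⊆G restricts)) m)
    lift-monitored R⊆G restricts r (x , y , inj₂ x∈Y , y∈Y , x≢y , m) =
      core x , core y , ∈-++ˡ x∈Y , ∈-++ˡ y∈Y , x≢y ∘ ↑ˡ-injective j x y ,
      Equivalence.from (monitors-embed⇔ (retraction R⊆G restricts)) m

    leaf-to-s₁ : ∀ {R : BoolRel (6 + j)} i → SoleSucc R (leaf i) (core s₀) →
                 Walk R (leaf i) (core s₁) → MonitoredIn R leafSet (leaf i) (core s₀)
    leaf-to-s₁ i succ w =
      leaf i , core s₁ , ∈-++ʳ outerLeaves ∈⊤ , there (there (there (there here))) , core≢leaf ∘ sym ,
      monitors-leaving-arc succ core≢leaf w

    leafSet-MEG : IsMEGSet G leafSet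
    leafSet-MEG p q e with view p | view q
    ... | core-view u | core-view v =
      [ (λ mf → let x , y , x∈ , y∈ , _ , m = lift mf in
                x , y , x∈ , y∈ , monitors-edge {G = G} m)
      , (λ mf → let x , y , x∈ , y∈ , _ , m = lift mf in
                x , y , x∈ , y∈ , monitors-edge-reversed {G = G} m)
      ]′ (net-edges-monitored u v (trans (sym (adj-core-core u v)) e))
      where
      lift : ∀ {u v} → MonitoredFrom (adj net) outerLeaves u v →
             MonitoredIn (adj G) leafSet (core u) (core v)
      lift = lift-monitored (λ _ _ e → e) adj-core-core
               (trans (Graph.sym G (leaf ℓ₀) (core s₀)) (hub-leaf ℓ₀))
    ... | core-view u | leaf-view i with ↑ˡ-injective j u s₀ (proj₂ (leaf-pendant i) (core u) e)
    ...   | refl = let x , y , x∈ , y∈ , _ , m = leaf-to-s₁ i (proj₁ (leaf-pendant i)) (G-connected _ _)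
                   in x , y , x∈ , y∈ , monitors-edge-reversed {G = G} m
    leafSet-MEG p q e | leaf-view i | core-view v
      with ↑ˡ-injective j v s₀ (proj₁ (leaf-pendant i) (core v) e)
    ...   | refl = let x , y , x∈ , y∈ , _ , m = leaf-to-s₁ i (proj₁ (leaf-pendant i)) (G-connected _ _)
                   in x , y , x∈ , y∈ , monitors-edge {G = G} m
    leafSet-MEG p q e | leaf-view i | leaf-view k = ⊥-elim (leaves-nonadjacent i k e)

    M⋆-MAG : IsMAGSet O⋆ M⋆
    M⋆-MAG p q r with view p | view q
    ... | core-view u | core-view v =
      let x , y , x∈ , y∈ , x≢y , m =
            lift-monitored (arc-edge O⋆) (extendInward-core-core cyclicOrientation)
              (extendInward-leaf-hub cyclicOrientation ℓ₀)
              (cyclic-arcs-monitored u v (trans (sym (extendInward-core-core cyclicOrientation u v)) r))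
      in x , y , x∈ , y∈ , x≢y , inj₁ m
    ... | core-view u | leaf-view i with trans (sym (extendInward-core-leaf cyclicOrientation u i)) r
    ...   | ()
    M⋆-MAG p q r | leaf-view i | core-view v
      with ↑ˡ-injective j v s₀ (proj₁ (leaf-pendant i) (core v) (arc-edge O⋆ (leaf i) (core v) r))
    ...   | refl = let x , y , x∈ , y∈ , x≢y , m = leaf-to-s₁ i succ (step r (lift s₀→s₁)) in
                   x , y , ∈-++ʳ cyclicCore ∈⊤ , there (there (there (there here))) , x≢y , inj₁ m
      where
      succ : SoleSucc (arc O⋆) (leaf i) (core s₀)
      succ = proj₁ (pendant-sub {ℓ = leaf i} (arc-edge O⋆) (leaf-pendant i))
      lift : ∀ {a b} → Walk (orient cyclic) a b → Walk (arc O⋆) (core a) (core b)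
      lift = embed-walk (retraction (arc-edge O⋆) (extendInward-core-core cyclicOrientation))
      s₀→s₁ : Walk (orient cyclic) s₀ s₁
      s₀→s₁ = from-yes (walk? {R = orient cyclic} s₀ s₁)
    M⋆-MAG p q r | leaf-view i | leaf-view k = ⊥-elim (leaves-nonadjacent i k (arc-edge O⋆ (leaf i) (leaf k) r))

    meg : IsMeg G (j + 2)
    meg = (leafSet , leafSet-MEG , ∣leafSet∣) , λ M → meg-lower-bound

    mag⁻ : IsMagMinus G (suc (j + 2))
    mag⁻ = (O⋆ , (M⋆ , M⋆-MAG , ∣M⋆∣) , λ M → mag-lower-bound O⋆) ,
           λ O k ((M , isM , ∣M∣≡k) , _) → subst (suc (j + 2) ≤_) ∣M∣≡k (mag-lower-bound O isM)

corollary5 : ∀ (j : ℕ) → 3 ≤ j →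
    ∃[ n ] Σ (Graph n) (λ G →
      Connected G × IsMeg G (j + 2) × ∃[ m ] (IsMagMinus G m × j + 2 < m))
corollary5 j@(suc _) _ = 6 + j , G , G-connected , meg zero , suc (j + 2) , mag⁻ zero , ≤-refl
  where open Construction j
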